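{- Let $q,q',n$ be integers with $q'\ge 2q>3$ and $n>1$. Let $S$ be an $\mathcal{OS}_q(n)$ with ring sequence $[s_0,\ldots,s_{m-1}]$. Let $T$ be the sequence over $\mathbb{Z}_{q'}$ with ring sequence $[t_0,\ldots,t_{m-1}]$, where $t_i=(-1)^{i+m-1}s'_i$ if $s'_i\neq 0$ and $t_i=(-1)^{i+m-1}q$ (in $\mathbb{Z}_{q'}$) if $s'_i=0$. Let $T'$ be the periodic sequence whose ring sequence is the concatenation $[t_0,\ldots,t_{m-1},-t_0,\ldots,-t_{m-1}]$ of the ring sequences of $T$ and $-T$. Then $T'$ is an $\mathcal{SOS}_{q'}(n)$ with $w_{q'}(T')=0$.
   Context: For $x\in\mathbb{Z}_q$, $x'$ denotes the residue class in $\mathbb{Z}_{q'}$ of the unique integer in $\{0,\ldots,q-1\}$ representing $x$. A periodic sequence of period $m$ is described by its ring sequence (one period). Write $\mathbf{s}_n(i)=(s_i,\ldots,s_{i+n-1})$; for an $n$-tuple $\mathbf{u}$, $\mathbf{u}^R$ is its reverse and $-\mathbf{u}$ its entrywise negative. An $n$-window sequence of period $m$ is one where $\mathbf{s}_n(i)=\mathbf{s}_n(j)$ implies $i\equiv j\pmod m$. An $\mathcal{OS}_q(n)$ is an $n$-window sequence over $\mathbb{Z}_q$ with $\mathbf{s}_n(i)\neq\mathbf{s}_n(j)^R$ for all $i,j$; an $\mathcal{SOS}_q(n)$ is an $\mathcal{OS}_q(n)$ with additionally $\mathbf{s}_n(i)\neq-\mathbf{s}_n(j)^R$ for all $i,j$.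 The weight $w(S)$ of a sequence over $\mathbb{Z}_{q'}$ is the sum of the terms of its ring sequence, each treated as an integer in $[0,q'-1]$; $w_{q'}(S)=w(S)\bmod q'$. -}

module Defs where

open import Data.Nat using (ℕ; zero; suc; _+_; _∸_; _≡ᵇ_; NonZero; ≢-nonZero; _%_)
open import Data.Nat.DivMod using (_mod_)
open import Data.Nat.Properties using (m+n≡0⇒m≡0)
open import Data.Fin using (Fin; toℕ; splitAt)
open import Data.Vec using (Vec; tabulate; reverse; map)
open import Data.List using (List) renaming (map to lmap)
open import Data.Nat.ListAction using (sum)
open import Data.List using (allFin)
open import Data.Sum using (inj₁; inj₂)
open import Data.Bool using (true; false)
open import Data.Product using (_×_)
open import Relation.Binary.PropositionalEquality using (_≡_; _≢_)
open import Relation.Nullary using (¬_)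

-- Z_q is represented by Fin q (residues 0..q-1).

negZ : (q : ℕ) .{{_ : NonZero q}} → Fin q → Fin q
negZ q x = (q ∸ toℕ x) mod q

-- x' : the residue in Z_{q'} of the representative of x in {0..q-1}
lift : {q : ℕ} (q' : ℕ) .{{_ : NonZero q'}} → Fin q → Fin q'
lift q' x = toℕ x mod q'

seqOf : {A : Set} (m : ℕ) .{{_ : NonZero m}} → (Fin m → A) → ℕ → A
seqOf m r i = r (i mod m)

window : {A : Set} → (ℕ → A) → (n : ℕ) → ℕ → Vec A n
window s n i = tabulate (λ k → s (i + toℕ k))

IsWindow : {A : Set} (n m : ℕ) .{{_ : NonZero m}} → (Fin m → A) → Set
IsWindow n m r = ∀ i j → window (seqOf m r) n i ≡ window (seqOf m r) n j → i % m ≡ j % m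

IsOS : (q n m : ℕ) .{{_ : NonZero m}} → (Fin m → Fin q) → Set
IsOS q n m r = IsWindow n m r ×
  (∀ i j → window (seqOf m r) n i ≢ reverse (window (seqOf m r) n j))

IsSOS : (q n m : ℕ) .{{_ : NonZero q}} .{{_ : NonZero m}} → (Fin m → Fin q) → Set
IsSOS q n m r = IsOS q n m r ×
  (∀ i j → window (seqOf m r) n i ≢ map (negZ q) (reverse (window (seqOf m r) n j)))

-- weight of a sequence with ring sequence r, terms as integers in [0, q'-1]
weight : {q' m : ℕ} → (Fin m → Fin q') → ℕ
weight {m = m} r = sum (lmap (λ k → toℕ (r k)) (allFin m))

even? : ℕ → Data.Bool.Bool
even? zero = true
even? (suc zero) = false
even? (suc (suc k)) = even? k

signZ : (q' : ℕ) .{{_ : NonZero q'}} → ℕ → Fin q' → Fin q'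
signZ q' k v with even? k
... | true  = v
... | false = negZ q' v

tSeq : (q q' m : ℕ) .{{_ : NonZero q'}} → (Fin m → Fin q) → Fin m → Fin q'
tSeq q q' m s i with toℕ (lift q' (s i)) ≡ᵇ 0
... | true  = signZ q' (toℕ i + m ∸ 1) (q mod q')
... | false = signZ q' (toℕ i + m ∸ 1) (lift q' (s i))

tPrime : (q q' m : ℕ) .{{_ : NonZero q'}} → (Fin m → Fin q) → Fin (m + m) → Fin q'
tPrime q q' m s k with splitAt m k
... | inj₁ i = tSeq q q' m s i
... | inj₂ i = negZ q' (tSeq q q' m s i)

nonZero-double : (m : ℕ) .{{_ : NonZero m}} → NonZero (m + m)
nonZero-double (suc m) = _

{-# OPTIONS --safe #-}
-- Folding x ∈ ℤ_{q'} to min(x, q' − x) mod q sends ±tᵢ back to sᵢ and is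
-- invariant under negation, so every window of T′ maps onto the window of S at the same
-- position, and a reversed or negated-reversed coincidence in T′ yields a reversed one in S.
-- Two equal windows of T′ therefore sit at positions congruent mod m, i.e. equal or m apart
-- mod 2m; since T′(x + m) = −T′(x), the second case makes a window equal to its own negation,
-- which forces all its (nonzero) entries to be q'/2, so it is a palindrome and so is its image
-- in S, which S forbids. The weight is m·q' because tᵢ + (−tᵢ) = q' for tᵢ ≠ 0.
module Submission where

open import Defs
open import Data.Bool using (Bool; true; false; not; T; if_then_else_)
open import Data.Bool.Properties using (¬-not) renaming (_≟_ to _≟ᵇ_)
open import Data.Empty using (⊥-elim)
open import Data.Unit using (tt)
open import Data.Product using (_×_; _,_; proj₁; proj₂)
open import Data.Sum using (_⊎_; inj₁; inj₂)
open import Data.Fin using (Fin; zero; suc; toℕ; _↑ˡ_; _↑ʳ_)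
open import Data.Fin.Properties using (toℕ-injective; toℕ-fromℕ<; toℕ-↑ˡ; toℕ-↑ʳ; toℕ<n; splitAt-↑ˡ; splitAt-↑ʳ)
open import Data.List using () renaming (tabulate to tabulateᴸ)
open import Data.List.Properties using (map-tabulate)
open import Data.Nat using (ℕ; zero; suc; _+_; _*_; _∸_; _⊓_; _≤_; _<_; _%_; _/_; _≡ᵇ_; NonZero; >-nonZero⁻¹; ≢-nonZero⁻¹; _≟_)
open import Data.Nat.DivMod
  using (_mod_; m≡m%n+[m/n]*n; m∣n⇒o%n%m≡o%m; m%[n*o]/o≡m/o%n; %-congʳ; %-distribˡ-+; [m+n]%n≡m%n;
         m<n⇒m%n≡m; n%n≡0; m/n≡1+[m∸n]/n; m*n%n≡0)
open import Data.Nat.Divisibility using (_∣_; ∣-refl; ∣m∣n⇒∣m+n)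
open import Data.Nat.ListAction using (sum)
open import Data.Nat.Properties
open import Algebra.Properties.CommutativeSemigroup +-commutativeSemigroup using (interchange; xy∙z≈xz∙y)
open import Data.Vec using (Vec; []; _∷_; _∷ʳ_; lookup; map; reverse; replicate)
open import Data.Vec.Properties using (reverse-∷; map-reverse; map-∘; map-cong; lookup-map; lookup∘tabulate; tabulate-∘; tabulate-cong)
open import Function using (_∘_; id)
open import Relation.Binary.PropositionalEquality
open import Relation.Nullary using (yes; no)
open ≡-Reasoning

toℕ-mod : ∀ x n .{{_ : NonZero n}} → toℕ (x mod n) ≡ x % n
toℕ-mod x n = toℕ-fromℕ< _

even?-suc : ∀ k → even? (suc k) ≡ not (even? k)
even?-suc zero          = refl
even?-suc (suc zero)    = refl
even?-suc (suc (suc k)) = even?-suc k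

[k%2]*m≡if-even? : ∀ k m → k % 2 * m ≡ (if even? k then 0 else m)
[k%2]*m≡if-even? zero          m = refl
[k%2]*m≡if-even? (suc zero)    m = +-identityʳ m
[k%2]*m≡if-even? (suc (suc k)) m = [k%2]*m≡if-even? k m

inHalf : ∀ {m} → Bool → Fin m → Fin (m + m)
inHalf {m} true  i = i ↑ˡ m
inHalf {m} false i = m ↑ʳ i

toℕ-inHalf : ∀ {m} b (i : Fin m) → toℕ (inHalf b i) ≡ toℕ i + (if b then 0 else m)
toℕ-inHalf {m} true  i = trans (toℕ-↑ˡ i m) (sym (+-identityʳ (toℕ i)))
toℕ-inHalf {m} false i = trans (toℕ-↑ʳ m i) (+-comm m (toℕ i))

module _ (m : ℕ) .{{_ : NonZero m}} where

  private instance
    m+m≢0 : NonZero (m + m)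
    m+m≢0 = nonZero-double m

  [x+m]/m≡1+x/m : ∀ x → (x + m) / m ≡ suc (x / m)
  [x+m]/m≡1+x/m x = trans (m/n≡1+[m∸n]/n (m≤n+m m x)) (cong (λ y → suc (y / m)) (m+n∸n≡m x m))

  even?-[x+m]/m : ∀ x → even? ((x + m) / m) ≡ not (even? (x / m))
  even?-[x+m]/m x = trans (cong even? ([x+m]/m≡1+x/m x)) (even?-suc (x / m))

  x%[m+m] : ∀ x → x % (m + m) ≡ x % m + (if even? (x / m) then 0 else m)
  x%[m+m] x = begin
    x % (m + m)                              ≡⟨ m≡m%n+[m/n]*n (x % (m + m)) m ⟩
    x % (m + m) % m + x % (m + m) / m * m    ≡⟨ cong₂ (λ a b → a + b * m) (m∣n⇒o%n%m≡o%m m (m + m) x m∣m+m) halves ⟩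
    x % m + x / m % 2 * m                    ≡⟨ cong (x % m +_) ([k%2]*m≡if-even? (x / m) m) ⟩
    x % m + (if even? (x / m) then 0 else m) ∎
    where
    m∣m+m : m ∣ m + m
    m∣m+m = ∣m∣n⇒∣m+n ∣-refl ∣-refl
    instance
      2m≢0 : NonZero (2 * m)
      2m≢0 = m*n≢0 2 m
    halves : x % (m + m) / m ≡ x / m % 2
    halves = trans (cong (_/ m) (%-congʳ (cong (m +_) (sym (+-identityʳ m))))) (m%[n*o]/o≡m/o%n x 2 m)

  %[m+m]-cong : ∀ x y → x % m ≡ y % m → even? (x / m) ≡ even? (y / m) → x % (m + m) ≡ y % (m + m)
  %[m+m]-cong x y x≡y even≡ = begin
    x % (m + m)                              ≡⟨ x%[m+m] x ⟩
    x % m + (if even? (x / m) then 0 else m) ≡⟨ cong₂ (λ a b → a + (if b then 0 else m)) x≡y even≡ ⟩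
    y % m + (if even? (y / m) then 0 else m) ≡⟨ x%[m+m] y ⟨
    y % (m + m)                              ∎

  %[m+m]-same-or-shifted : ∀ i j → i % m ≡ j % m → i % (m + m) ≡ j % (m + m) ⊎ j % (m + m) ≡ (i + m) % (m + m)
  %[m+m]-same-or-shifted i j i≡j with even? (i / m) ≟ᵇ even? (j / m)
  ... | yes same  = inj₁ (%[m+m]-cong i j i≡j same)
  ... | no  other = inj₂ (%[m+m]-cong j (i + m) (trans (sym i≡j) (sym ([m+n]%n≡m%n i m)))
                                                (trans (¬-not (other ∘ sym)) (sym (even?-[x+m]/m i))))

  x-mod-[m+m] : ∀ x → x mod (m + m) ≡ inHalf (even? (x / m)) (x mod m)
  x-mod-[m+m] x = toℕ-injective (begin
    toℕ (x mod (m + m))                              ≡⟨ toℕ-mod x (m + m) ⟩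
    x % (m + m)                                      ≡⟨ x%[m+m] x ⟩
    x % m + (if even? (x / m) then 0 else m)         ≡⟨ cong (_+ (if even? (x / m) then 0 else m)) (toℕ-mod x m) ⟨
    toℕ (x mod m) + (if even? (x / m) then 0 else m) ≡⟨ toℕ-inHalf (even? (x / m)) (x mod m) ⟨
    toℕ (inHalf (even? (x / m)) (x mod m))           ∎)

  [x+m]-mod-m : ∀ x → (x + m) mod m ≡ x mod m
  [x+m]-mod-m x = toℕ-injective (trans (toℕ-mod (x + m) m) (trans ([m+n]%n≡m%n x m) (sym (toℕ-mod x m))))

module _ {A B : Set} where

  window-map : {u : ℕ → A} {v : ℕ → B} {f : A → B} → (∀ x → f (u x) ≡ v x) →
               ∀ n i → map f (window u n i) ≡ window v n i
  window-map {f = f} fu≡v n i = trans (sym (tabulate-∘ f _)) (tabulate-cong (λ k → fu≡v (i + toℕ k)))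

module _ {A : Set} where

  window-shift : {u : ℕ → A} {f : A → A} {p : ℕ} → (∀ x → u (x + p) ≡ f (u x)) →
                 ∀ n i → window u n (i + p) ≡ map f (window u n i)
  window-shift {u} {f} {p} shift n i = trans (tabulate-cong step) (tabulate-∘ f _)
    where
    step : ∀ k → u (i + p + toℕ k) ≡ f (u (i + toℕ k))
    step k = trans (cong u (xy∙z≈xz∙y i p (toℕ k))) (shift (i + toℕ k))

  window-periodic : ∀ {m} .{{_ : NonZero m}} (r : Fin m → A) n i j → i % m ≡ j % m →
                    window (seqOf m r) n i ≡ window (seqOf m r) n j
  window-periodic {m} r n i j i≡j = tabulate-cong (λ k → cong r (toℕ-injective (begin
    toℕ ((i + toℕ k) mod m)     ≡⟨ toℕ-mod (i + toℕ k) m ⟩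
    (i + toℕ k) % m             ≡⟨ %-distribˡ-+ i (toℕ k) m ⟩
    (i % m + toℕ k % m) % m     ≡⟨ cong (λ a → (a + toℕ k % m) % m) i≡j ⟩
    (j % m + toℕ k % m) % m     ≡⟨ %-distribˡ-+ j (toℕ k) m ⟨
    (j + toℕ k) % m             ≡⟨ toℕ-mod (j + toℕ k) m ⟨
    toℕ ((j + toℕ k) mod m)     ∎)))

  replicate-∷ʳ : ∀ n (x : A) → replicate n x ∷ʳ x ≡ x ∷ replicate n x
  replicate-∷ʳ zero    x = refl
  replicate-∷ʳ (suc n) x = cong (x ∷_) (replicate-∷ʳ n x)

  reverse-replicate : ∀ n (x : A) → reverse (replicate n x) ≡ replicate n x
  reverse-replicate zero    x = refl
  reverse-replicate (suc n) x = begin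
    reverse (x ∷ replicate n x)  ≡⟨ reverse-∷ x (replicate n x) ⟩
    reverse (replicate n x) ∷ʳ x ≡⟨ cong (_∷ʳ x) (reverse-replicate n x) ⟩
    replicate n x ∷ʳ x           ≡⟨ replicate-∷ʳ n x ⟩
    x ∷ replicate n x            ∎

  lookup-const⇒≡replicate : ∀ {n} (v : Vec A n) {x : A} → (∀ k → lookup v k ≡ x) → v ≡ replicate n x
  lookup-const⇒≡replicate []      _     = refl
  lookup-const⇒≡replicate (y ∷ v) const = cong₂ _∷_ (const zero) (lookup-const⇒≡replicate v (const ∘ suc))

  reverse-constant : ∀ {n} (v : Vec A n) → (∀ k l → lookup v k ≡ lookup v l) → reverse v ≡ v
  reverse-constant []      _    = refl
  reverse-constant (x ∷ v) same = begin
    reverse (x ∷ v)                ≡⟨ cong reverse v≡x* ⟩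
    reverse (replicate (suc _) x)  ≡⟨ reverse-replicate _ x ⟩
    replicate (suc _) x            ≡⟨ v≡x* ⟨
    x ∷ v                          ∎
    where
    v≡x* : x ∷ v ≡ replicate _ x
    v≡x* = lookup-const⇒≡replicate (x ∷ v) (λ k → same k zero)

sum-tabulate-↑ : ∀ m {n} (f : Fin (m + n) → ℕ) →
                 sum (tabulateᴸ f) ≡ sum (tabulateᴸ (f ∘ (_↑ˡ n))) + sum (tabulateᴸ (f ∘ (m ↑ʳ_)))
sum-tabulate-↑ zero    f = refl
sum-tabulate-↑ (suc m) f = trans (cong (f zero +_) (sum-tabulate-↑ m (f ∘ suc))) (sym (+-assoc (f zero) _ _))

sum-tabulate-pairs : ∀ m (f g : Fin m → ℕ) {c} → (∀ i → f i + g i ≡ c) → sum (tabulateᴸ f) + sum (tabulateᴸ g) ≡ m * c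
sum-tabulate-pairs zero    f g pairs = refl
sum-tabulate-pairs (suc m) f g {c} pairs = begin
  (f zero + sum (tabulateᴸ (f ∘ suc))) + (g zero + sum (tabulateᴸ (g ∘ suc))) ≡⟨ interchange (f zero) _ (g zero) _ ⟩
  (f zero + g zero) + (sum (tabulateᴸ (f ∘ suc)) + sum (tabulateᴸ (g ∘ suc))) ≡⟨ cong₂ _+_ (pairs zero) (sum-tabulate-pairs m (f ∘ suc) (g ∘ suc) (pairs ∘ suc)) ⟩
  c + m * c                                                                   ∎

module _ {q : ℕ} .{{_ : NonZero q}} where

  toℕ-negZ : (x : Fin q) → toℕ x ≢ 0 → toℕ (negZ q x) ≡ q ∸ toℕ x
  toℕ-negZ x x≢0 = trans (toℕ-mod (q ∸ toℕ x) q) (m<n⇒m%n≡m (∸-monoʳ-< (n≢0⇒n>0 x≢0) (<⇒≤ (toℕ<n x))))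

  toℕ-negZ-0 : (x : Fin q) → toℕ x ≡ 0 → toℕ (negZ q x) ≡ 0
  toℕ-negZ-0 x x≡0 = trans (toℕ-mod (q ∸ toℕ x) q) (trans (cong (λ v → (q ∸ v) % q) x≡0) (n%n≡0 q))

  toℕ+toℕ-negZ : (x : Fin q) → toℕ x ≢ 0 → toℕ x + toℕ (negZ q x) ≡ q
  toℕ+toℕ-negZ x x≢0 = trans (cong (toℕ x +_) (toℕ-negZ x x≢0)) (m+[n∸m]≡n (<⇒≤ (toℕ<n x)))

  negZ-nonzero : (x : Fin q) → toℕ x ≢ 0 → toℕ (negZ q x) ≢ 0
  negZ-nonzero x x≢0 -x≡0 = <⇒≢ (toℕ<n x) (begin
    toℕ x                    ≡⟨ +-identityʳ (toℕ x) ⟨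
    toℕ x + 0                ≡⟨ cong (toℕ x +_) -x≡0 ⟨
    toℕ x + toℕ (negZ q x)   ≡⟨ toℕ+toℕ-negZ x x≢0 ⟩
    q                        ∎)

  negZ-involutive : (x : Fin q) → negZ q (negZ q x) ≡ x
  negZ-involutive x with toℕ x ≟ 0
  ... | yes x≡0 = toℕ-injective (trans (toℕ-negZ-0 (negZ q x) (toℕ-negZ-0 x x≡0)) (sym x≡0))
  ... | no  x≢0 = toℕ-injective (begin
    toℕ (negZ q (negZ q x)) ≡⟨ toℕ-negZ (negZ q x) (negZ-nonzero x x≢0) ⟩
    q ∸ toℕ (negZ q x)      ≡⟨ cong (q ∸_) (toℕ-negZ x x≢0) ⟩
    q ∸ (q ∸ toℕ x)         ≡⟨ m∸[m∸n]≡n (<⇒≤ (toℕ<n x)) ⟩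
    toℕ x                   ∎)

  negZ-fixed-unique : (x y : Fin q) → toℕ x ≢ 0 → toℕ y ≢ 0 → negZ q x ≡ x → negZ q y ≡ y → x ≡ y
  negZ-fixed-unique x y x≢0 y≢0 -x≡x -y≡y = toℕ-injective (*-cancelˡ-≡ _ _ 2 (trans (double x x≢0 -x≡x) (sym (double y y≢0 -y≡y))))
    where
    double : (z : Fin q) → toℕ z ≢ 0 → negZ q z ≡ z → 2 * toℕ z ≡ q
    double z z≢0 -z≡z = begin
      toℕ z + (toℕ z + 0)    ≡⟨ cong (toℕ z +_) (+-identityʳ (toℕ z)) ⟩
      toℕ z + toℕ z          ≡⟨ cong (λ w → toℕ z + toℕ w) -z≡z ⟨
      toℕ z + toℕ (negZ q z) ≡⟨ toℕ+toℕ-negZ z z≢0 ⟩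
      q                      ∎

-- Recovers sᵢ from ±tᵢ: the absolute value min(x, q' − x) of x ∈ ℤ_{q'}, reduced mod q,
-- sends ±s'ᵢ to sᵢ and ±q to 0.
absMod : (q : ℕ) .{{_ : NonZero q}} {q' : ℕ} → Fin q' → Fin q
absMod q {q'} x = (toℕ x ⊓ (q' ∸ toℕ x)) mod q

module _ {q q' : ℕ} .{{_ : NonZero q}} .{{_ : NonZero q'}} where

  absMod-negZ : (x : Fin q') → absMod q (negZ q' x) ≡ absMod q x
  absMod-negZ x with toℕ x ≟ 0
  ... | yes x≡0 = cong (λ v → (v ⊓ (q' ∸ v)) mod q) (trans (toℕ-negZ-0 x x≡0) (sym x≡0))
  ... | no  x≢0 = cong (_mod q) (begin
    toℕ (negZ q' x) ⊓ (q' ∸ toℕ (negZ q' x)) ≡⟨ cong (λ v → v ⊓ (q' ∸ v)) (toℕ-negZ x x≢0) ⟩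
    (q' ∸ toℕ x) ⊓ (q' ∸ (q' ∸ toℕ x))       ≡⟨ cong ((q' ∸ toℕ x) ⊓_) (m∸[m∸n]≡n (<⇒≤ (toℕ<n x))) ⟩
    (q' ∸ toℕ x) ⊓ toℕ x                     ≡⟨ ⊓-comm (q' ∸ toℕ x) (toℕ x) ⟩
    toℕ x ⊓ (q' ∸ toℕ x)                     ∎)

  absMod-signZ : ∀ k (x : Fin q') → absMod q (signZ q' k x) ≡ absMod q x
  absMod-signZ k x with even? k
  ... | true  = refl
  ... | false = absMod-negZ x

  signZ-nonzero : ∀ k (x : Fin q') → toℕ x ≢ 0 → toℕ (signZ q' k x) ≢ 0
  signZ-nonzero k x x≢0 with even? k
  ... | true  = x≢0
  ... | false = negZ-nonzero x x≢0

  module _ (2q≤q' : 2 * q ≤ q') where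

    private
      q+q≤q' : q + q ≤ q'
      q+q≤q' = subst (_≤ q') (cong (q +_) (+-identityʳ q)) 2q≤q'

      q<q' : q < q'
      q<q' = ≤-trans (m<m+n q (>-nonZero⁻¹ q)) q+q≤q'

    toℕ-absMod-small : ∀ (x : Fin q') → toℕ x ≤ q → toℕ (absMod q x) ≡ toℕ x % q
    toℕ-absMod-small x x≤q = trans (toℕ-mod _ q) (cong (_% q) (m≤n⇒m⊓n≡m (m+n≤o⇒m≤o∸n (toℕ x) x+x≤q')))
      where
      x+x≤q' : toℕ x + toℕ x ≤ q'
      x+x≤q' = ≤-trans (+-mono-≤ x≤q x≤q) q+q≤q'

    toℕ-lift : (x : Fin q) → toℕ (lift q' x) ≡ toℕ x
    toℕ-lift x = trans (toℕ-mod (toℕ x) q') (m<n⇒m%n≡m (<-trans (toℕ<n x) q<q'))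

    absMod-lift : (x : Fin q) → absMod q (lift q' x) ≡ x
    absMod-lift x = toℕ-injective (begin
      toℕ (absMod q (lift q' x)) ≡⟨ toℕ-absMod-small (lift q' x) (≤-trans (≤-reflexive (toℕ-lift x)) (<⇒≤ (toℕ<n x))) ⟩
      toℕ (lift q' x) % q        ≡⟨ cong (_% q) (toℕ-lift x) ⟩
      toℕ x % q                  ≡⟨ m<n⇒m%n≡m (toℕ<n x) ⟩
      toℕ x                      ∎)

    toℕ-q-mod-q' : toℕ (q mod q') ≡ q
    toℕ-q-mod-q' = trans (toℕ-mod q q') (m<n⇒m%n≡m q<q')

    toℕ-absMod-q : toℕ (absMod q (q mod q')) ≡ 0
    toℕ-absMod-q = begin
      toℕ (absMod q (q mod q')) ≡⟨ toℕ-absMod-small (q mod q') (≤-reflexive toℕ-q-mod-q') ⟩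
      toℕ (q mod q') % q        ≡⟨ cong (_% q) toℕ-q-mod-q' ⟩
      q % q                     ≡⟨ n%n≡0 q ⟩
      0                         ∎

    module _ {m : ℕ} (s : Fin m → Fin q) where

      absMod-tSeq : (i : Fin m) → absMod q (tSeq q q' m s i) ≡ s i
      absMod-tSeq i with toℕ (lift q' (s i)) ≡ᵇ 0 in s'ᵢ≟0
      ... | true  = trans (absMod-signZ (toℕ i + m ∸ 1) (q mod q')) (toℕ-injective (trans toℕ-absMod-q (sym sᵢ≡0)))
        where
        sᵢ≡0 : toℕ (s i) ≡ 0
        sᵢ≡0 = trans (sym (toℕ-lift (s i))) (≡ᵇ⇒≡ _ 0 (subst T (sym s'ᵢ≟0) tt))
      ... | false = trans (absMod-signZ (toℕ i + m ∸ 1) (lift q' (s i))) (absMod-lift (s i))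

      tSeq-nonzero : (i : Fin m) → toℕ (tSeq q q' m s i) ≢ 0
      tSeq-nonzero i with toℕ (lift q' (s i)) ≡ᵇ 0 in s'ᵢ≟0
      ... | true  = signZ-nonzero (toℕ i + m ∸ 1) (q mod q') (λ q≡0 → ≢-nonZero⁻¹ q (trans (sym toℕ-q-mod-q') q≡0))
      ... | false = signZ-nonzero (toℕ i + m ∸ 1) (lift q' (s i)) (λ s'ᵢ≡0 → subst T s'ᵢ≟0 (≡⇒≡ᵇ _ 0 s'ᵢ≡0))

module _ {q : ℕ} (q' : ℕ) .{{_ : NonZero q'}} {m : ℕ} (s : Fin m → Fin q) where

  tPrime-↑ˡ : (i : Fin m) → tPrime q q' m s (i ↑ˡ m) ≡ tSeq q q' m s i
  tPrime-↑ˡ i rewrite splitAt-↑ˡ m i m = refl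

  tPrime-↑ʳ : (i : Fin m) → tPrime q q' m s (m ↑ʳ i) ≡ negZ q' (tSeq q q' m s i)
  tPrime-↑ʳ i rewrite splitAt-↑ʳ m m i = refl

  tPrime-inHalf-not : ∀ b (i : Fin m) → tPrime q q' m s (inHalf (not b) i) ≡ negZ q' (tPrime q q' m s (inHalf b i))
  tPrime-inHalf-not true  i = trans (tPrime-↑ʳ i) (cong (negZ q') (sym (tPrime-↑ˡ i)))
  tPrime-inHalf-not false i = begin
    tPrime q q' m s (i ↑ˡ m)                ≡⟨ tPrime-↑ˡ i ⟩
    tSeq q q' m s i                         ≡⟨ negZ-involutive (tSeq q q' m s i) ⟨
    negZ q' (negZ q' (tSeq q q' m s i))     ≡⟨ cong (negZ q') (tPrime-↑ʳ i) ⟨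
    negZ q' (tPrime q q' m s (m ↑ʳ i))      ∎

  module _ .{{_ : NonZero m}} where

    private instance
      m+m≢0 : NonZero (m + m)
      m+m≢0 = nonZero-double m

    T′ : ℕ → Fin q'
    T′ = seqOf (m + m) (tPrime q q' m s)

    T′≡tPrime-inHalf : ∀ x → T′ x ≡ tPrime q q' m s (inHalf (even? (x / m)) (x mod m))
    T′≡tPrime-inHalf x = cong (tPrime q q' m s) (x-mod-[m+m] m x)

    T′-antiperiodic : ∀ x → T′ (x + m) ≡ negZ q' (T′ x)
    T′-antiperiodic x = begin
      T′ (x + m)                                                          ≡⟨ T′≡tPrime-inHalf (x + m) ⟩
      tPrime q q' m s (inHalf (even? ((x + m) / m)) ((x + m) mod m))      ≡⟨ cong₂ (λ b i → tPrime q q' m s (inHalf b i)) (even?-[x+m]/m m x) ([x+m]-mod-m m x) ⟩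
      tPrime q q' m s (inHalf (not (even? (x / m))) (x mod m))            ≡⟨ tPrime-inHalf-not (even? (x / m)) (x mod m) ⟩
      negZ q' (tPrime q q' m s (inHalf (even? (x / m)) (x mod m)))        ≡⟨ cong (negZ q') (T′≡tPrime-inHalf x) ⟨
      negZ q' (T′ x)                                                      ∎

module _ {q q' : ℕ} .{{_ : NonZero q}} .{{_ : NonZero q'}} (2q≤q' : 2 * q ≤ q') {m : ℕ} (s : Fin m → Fin q) where

  weight-tPrime : weight (tPrime q q' m s) ≡ m * q'
  weight-tPrime = begin
    weight (tPrime q q' m s)                   ≡⟨ cong sum (map-tabulate id toℕ-t′) ⟩
    sum (tabulateᴸ toℕ-t′)                      ≡⟨ sum-tabulate-↑ m toℕ-t′ ⟩
    sum (tabulateᴸ (toℕ-t′ ∘ (_↑ˡ m))) + sum (tabulateᴸ (toℕ-t′ ∘ (m ↑ʳ_))) ≡⟨ sum-tabulate-pairs m _ _ pair ⟩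
    m * q'                                     ∎
    where
    toℕ-t′ : Fin (m + m) → ℕ
    toℕ-t′ k = toℕ (tPrime q q' m s k)
    pair : ∀ i → toℕ-t′ (i ↑ˡ m) + toℕ-t′ (m ↑ʳ i) ≡ q'
    pair i = trans (cong₂ (λ a b → toℕ a + toℕ b) (tPrime-↑ˡ q' s i) (tPrime-↑ʳ q' s i))
                   (toℕ+toℕ-negZ _ (tSeq-nonzero 2q≤q' s i))

  absMod-tPrime-inHalf : ∀ b (i : Fin m) → absMod q (tPrime q q' m s (inHalf b i)) ≡ s i
  absMod-tPrime-inHalf true  i = trans (cong (absMod q) (tPrime-↑ˡ q' s i)) (absMod-tSeq 2q≤q' s i)
  absMod-tPrime-inHalf false i = begin
    absMod q (tPrime q q' m s (m ↑ʳ i))       ≡⟨ cong (absMod q) (tPrime-↑ʳ q' s i) ⟩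
    absMod q (negZ q' (tSeq q q' m s i))      ≡⟨ absMod-negZ _ ⟩
    absMod q (tSeq q q' m s i)                ≡⟨ absMod-tSeq 2q≤q' s i ⟩
    s i                                       ∎

  tPrime-inHalf-nonzero : ∀ b (i : Fin m) → toℕ (tPrime q q' m s (inHalf b i)) ≢ 0
  tPrime-inHalf-nonzero true  i = subst (λ x → toℕ x ≢ 0) (sym (tPrime-↑ˡ q' s i)) (tSeq-nonzero 2q≤q' s i)
  tPrime-inHalf-nonzero false i = subst (λ x → toℕ x ≢ 0) (sym (tPrime-↑ʳ q' s i)) (negZ-nonzero _ (tSeq-nonzero 2q≤q' s i))

  module _ .{{_ : NonZero m}} where

    private instance
      m+m≢0 : NonZero (m + m)
      m+m≢0 = nonZero-double m

    absMod-T′ : ∀ x → absMod q (T′ q' s x) ≡ seqOf m s x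
    absMod-T′ x = trans (cong (absMod q) (T′≡tPrime-inHalf q' s x)) (absMod-tPrime-inHalf (even? (x / m)) (x mod m))

    T′-nonzero : ∀ x → toℕ (T′ q' s x) ≢ 0
    T′-nonzero x = subst (λ y → toℕ y ≢ 0) (sym (T′≡tPrime-inHalf q' s x)) (tPrime-inHalf-nonzero (even? (x / m)) (x mod m))

    module _ (n : ℕ) (os : IsOS q n m s) where

      private
        S W : ℕ → Vec _ n
        S = window (seqOf m s) n
        W = window (T′ q' s) n

        S-window : IsWindow n m s
        S-window = proj₁ os

        S-no-reverse : ∀ i j → S i ≢ reverse (S j)
        S-no-reverse = proj₂ os

        absMod-W : ∀ i → map (absMod q) (W i) ≡ S i
        absMod-W = window-map absMod-T′ n

        W≡⇒S≡ : ∀ {i j} → W i ≡ W j → S i ≡ S j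
        W≡⇒S≡ {i} {j} Wi≡Wj = trans (sym (absMod-W i)) (trans (cong (map (absMod q)) Wi≡Wj) (absMod-W j))

        absMod-reverse-W : ∀ j → map (absMod q) (reverse (W j)) ≡ reverse (S j)
        absMod-reverse-W j = trans (map-reverse (absMod q) (W j)) (cong reverse (absMod-W j))

      T′-window-not-negZ-fixed : ∀ i → W i ≢ map (negZ q') (W i)
      T′-window-not-negZ-fixed i W≡-W = S-no-reverse i i (begin
        S i                             ≡⟨ absMod-W i ⟨
        map (absMod q) (W i)            ≡⟨ cong (map (absMod q)) palindrome ⟨
        map (absMod q) (reverse (W i))  ≡⟨ absMod-reverse-W i ⟩
        reverse (S i)                   ∎)
        where
        entry : ∀ k → lookup (W i) k ≡ T′ q' s (i + toℕ k)
        entry k = lookup∘tabulate _ k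
        fixed : ∀ k → negZ q' (lookup (W i) k) ≡ lookup (W i) k
        fixed k = sym (trans (cong (λ v → lookup v k) W≡-W) (lookup-map k (negZ q') (W i)))
        nonzero : ∀ k → toℕ (lookup (W i) k) ≢ 0
        nonzero k = subst (λ y → toℕ y ≢ 0) (sym (entry k)) (T′-nonzero (i + toℕ k))
        palindrome : reverse (W i) ≡ W i
        palindrome = reverse-constant (W i) (λ k l → negZ-fixed-unique _ _ (nonzero k) (nonzero l) (fixed k) (fixed l))

      T′-isWindow : IsWindow n (m + m) (tPrime q q' m s)
      T′-isWindow i j Wi≡Wj with %[m+m]-same-or-shifted m i j (S-window i j (W≡⇒S≡ Wi≡Wj))
      ... | inj₁ i≡j   = i≡j
      ... | inj₂ j≡i+m = ⊥-elim (T′-window-not-negZ-fixed i (begin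
        W i                 ≡⟨ Wi≡Wj ⟩
        W j                 ≡⟨ window-periodic (tPrime q q' m s) n j (i + m) j≡i+m ⟩
        W (i + m)           ≡⟨ window-shift {u = T′ q' s} (T′-antiperiodic q' s) n i ⟩
        map (negZ q') (W i) ∎))

      T′-no-reverse : ∀ i j → W i ≢ reverse (W j)
      T′-no-reverse i j Wi≡rWj = S-no-reverse i j (begin
        S i                             ≡⟨ absMod-W i ⟨
        map (absMod q) (W i)            ≡⟨ cong (map (absMod q)) Wi≡rWj ⟩
        map (absMod q) (reverse (W j))  ≡⟨ absMod-reverse-W j ⟩
        reverse (S j)                   ∎)

      T′-no-negated-reverse : ∀ i j → W i ≢ map (negZ q') (reverse (W j))
      T′-no-negated-reverse i j Wi≡-rWj = S-no-reverse i j (begin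
        S i                                             ≡⟨ absMod-W i ⟨
        map (absMod q) (W i)                            ≡⟨ cong (map (absMod q)) Wi≡-rWj ⟩
        map (absMod q) (map (negZ q') (reverse (W j)))  ≡⟨ map-∘ (absMod q) (negZ q') (reverse (W j)) ⟨
        map (absMod q ∘ negZ q') (reverse (W j))        ≡⟨ map-cong absMod-negZ (reverse (W j)) ⟩
        map (absMod q) (reverse (W j))                  ≡⟨ absMod-reverse-W j ⟩
        reverse (S j)                                   ∎)

theorem3p15 : (q q' n m : ℕ) .{{_ : NonZero q}} .{{nz' : NonZero q'}} .{{_ : NonZero m}} →
    2 * q ≤ q' → 3 < 2 * q → 1 < n →
    (s : Fin m → Fin q) → IsOS q n m s →
    IsSOS q' n (m + m) {{nz'}} {{nonZero-double m}} (tPrime q q' m s)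
      × weight (tPrime q q' m s) % q' ≡ 0
theorem3p15 q q' n m 2q≤q' _ _ s os =
  ((T′-isWindow 2q≤q' s n os , T′-no-reverse 2q≤q' s n os) , T′-no-negated-reverse 2q≤q' s n os) ,
  trans (cong (_% q') (weight-tPrime 2q≤q' s)) (m*n%n≡0 m q')
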